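{- Let $\Pi$ be a symbolic derivation in $\mathrm{FVLS}_{\mathrm{BBI}}$. Then $(\mathcal{C}(\Pi),\preceq^\Pi)$ is a constraint system. Moreover, if the root sequent is ground, then $(\mathcal{C}(\Pi),\preceq^\Pi)$ is well-formed.
   Context: Labels are label variables or the constant $\epsilon$; free variables $\mathbf{x},\mathbf{y},\mathbf{z}$ are existential variables standing for labels; $\mathbf{u},\mathbf{v},\mathbf{w}$ denote labels or free variables. A relational atom is $(\mathbf{u},\mathbf{v}\triangleright\mathbf{w})$. A symbolic sequent $\mathcal{G}\,||\,\Gamma\vdash\Delta$ ($\mathcal{G}$ relational atoms, $\Gamma,\Delta$ labelled formulae $\mathbf{w}:A$ of BBI) may contain free variables; a ground sequent contains none. The symbolic calculus $\mathrm{FVLS}_{\mathrm{BBI}}$ has rules (premises $\Rightarrow$ conclusion): id: $\mathcal{G}||\Gamma;\mathbf{w}_1:P\vdash\mathbf{w}_2:P;\Delta$ (no side condition); $\bot L$: $\mathcal{G}||\Gamma;\mathbf{w}:\bot\vdash\Delta$; $\top R$: $\mathcal{G}||\Gamma\vdash\mathbf{w}:\top;\Delta$; $\top^*R$: $\mathcal{G}||\Gamma\vdash\mathbf{w}:\top^*;\Delta$ (no side condition); $\top^*L$: $\mathcal{G};(\epsilon,\mathbf{w}\triangleright\epsilon)||\Gamma\vdash\Delta\Rightarrow\mathcal{G}||\Gamma;\mathbf{w}:\top^*\vdash\Delta$; classical $\land L,\land R,\to L,\to R$ with unchanged labels; $\ast L$: $\mathcal{G};(a,b\triangleright\mathbf{w})||\Gamma;a:A;b:B\vdash\Delta\Rightarrow\mathcal{G}||\Gamma;\mathbf{w}:A\ast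 B\vdash\Delta$ ($a,b$ fresh labels); $\mathrel{ -\!\!\ast} R$: $\mathcal{G};(a,\mathbf{w}\triangleright c)||\Gamma;a:A\vdash c:B;\Delta\Rightarrow\mathcal{G}||\Gamma\vdash\mathbf{w}:A\mathrel{ -\!\!\ast} B;\Delta$ ($a,c$ fresh labels); $\ast R$: $\mathcal{G}||\Gamma\vdash\mathbf{x}:A;\mathbf{w}:A\ast B;\Delta$ and $\mathcal{G}||\Gamma\vdash\mathbf{y}:B;\mathbf{w}:A\ast B;\Delta\Rightarrow\mathcal{G}||\Gamma\vdash\mathbf{w}:A\ast B;\Delta$ ($\mathbf{x},\mathbf{y}$ new free variables); $\mathrel{ -\!\!\ast} L$: $\mathcal{G}||\Gamma;\mathbf{w}:A\mathrel{ -\!\!\ast} B\vdash\mathbf{x}:A;\Delta$ and $\mathcal{G}||\Gamma;\mathbf{w}:A\mathrel{ -\!\!\ast} B;\mathbf{z}:B\vdash\Delta\Rightarrow\mathcal{G}||\Gamma;\mathbf{w}:A\mathrel{ -\!\!\ast} B\vdash\Delta$ ($\mathbf{x},\mathbf{z}$ new free variables). Free variables created in different branches are pairwise distinct. An equality constraint is $\mathcal{G}\vdash^?_R(\mathbf{u}=\mathbf{v})$ and a relational constraint is $\mathcal{G}\vdash^?_R(\mathbf{u},\mathbf{v}\triangleright\mathbf{w})$; $\mathcal{G}(\mathfrak{c})$ denotes the left-hand side of $\mathfrak{c}$. $\mathcal{C}(\Pi)$ is defined by the lowest rule of $\Pi$: id gives $\{\mathcal{G}\vdash^?_R(\mathbf{w}_1=\mathbf{w}_2)\}$;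 $\top^*R$ gives $\{\mathcal{G}\vdash^?_R(\mathbf{w}=\epsilon)\}$; $\ast R$ gives $\mathcal{C}(\Pi_1)\cup\mathcal{C}(\Pi_2)\cup\{\mathcal{G}\vdash^?_R(\mathbf{x},\mathbf{y}\triangleright\mathbf{w})\}$; $\mathrel{ -\!\!\ast} L$ gives $\mathcal{C}(\Pi_1)\cup\mathcal{C}(\Pi_2)\cup\{\mathcal{G}\vdash^?_R(\mathbf{x},\mathbf{w}\triangleright\mathbf{z})\}$; any other rule gives the union of the premise sets. Each constraint $\mathfrak{c}$ corresponds to the rule instance $r(\mathfrak{c})$ generating it, and $\mathfrak{c}_1\preceq^\Pi\mathfrak{c}_2$ iff the conclusion of $r(\mathfrak{c}_1)$ lies on the path from the root to the conclusion of $r(\mathfrak{c}_2)$. A constraint system is a pair $(\mathcal{C},\preceq)$ of a set of constraints and a well-founded partial order on it satisfying monotonicity: $\mathfrak{c}_1\preceq\mathfrak{c}_2$ implies $\mathcal{G}(\mathfrak{c}_1)\subseteq\mathcal{G}(\mathfrak{c}_2)$. It is well-formed if moreover (unique variable origin) for every free variable $\mathbf{x}$ in $\mathcal{C}$ there is a unique $\preceq$-minimum relational constraint $\mathfrak{c}(\mathbf{x})=\mathcal{G}_x\vdash^?_R(\mathbf{u},\mathbf{v}\triangleright\mathbf{w})$ such that $\mathbf{x}$ occurs in $(\mathbf{u},\mathbf{v}\triangleright\mathbf{w})$ but not in $\mathcal{G}_x$, and $\mathbf{x}$ occurs in no $\mathfrak{c}'$ with $\mathfrak{c}'\preceq\mathfrak{c}(\mathbf{x})$.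 -}

module Defs where

open import Data.Nat using (ℕ)
open import Data.List using (List; []; _∷_; _++_; map; concatMap)
open import Data.List.Membership.Propositional using (_∈_; _∉_)
open import Data.List.Relation.Binary.Subset.Propositional using (_⊆_)
open import Data.List.Relation.Binary.Permutation.Propositional using (_↭_)
open import Data.Product using (Σ; ∃; ∃-syntax; _×_; _,_)
open import Data.Sum using (_⊎_; inj₁; inj₂)
open import Data.Unit using (⊤; tt)
open import Data.Empty using (⊥)
open import Relation.Nullary using (¬_)
open import Relation.Binary.PropositionalEquality using (_≡_; _≢_)
open import Relation.Binary.Structures using (IsPartialOrder)
open import Induction.WellFounded using (WellFounded)

data Label : Set where
  lv : ℕ → Label
  ε  : Label

-- Labels or free (existential) variables.
data Term : Set where
  lab : Label → Term
  var : ℕ → Term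

data Formula : Set where
  atom      : ℕ → Formula
  ⊤f ⊥f ⊤*  : Formula
  _∧f_ _⇒f_ : Formula → Formula → Formula
  _∗_ _−∗_  : Formula → Formula → Formula

record RelAtom : Set where
  constructor ⟨_,_▷_⟩
  field u v w : Term

termsA : RelAtom → List Term
termsA ⟨ u , v ▷ w ⟩ = u ∷ v ∷ w ∷ []

infix 6 _∶_
record LForm : Set where
  constructor _∶_
  field lbl : Term
        fml : Formula

infix 3 _∥_⊢_
data Seq : Set where
  _∥_⊢_ : List RelAtom → List LForm → List LForm → Seq

termsR : List RelAtom → List Term
termsR = concatMap termsA

termsL : List LForm → List Term
termsL = map LForm.lbl

seqTerms : Seq → List Term
seqTerms (G ∥ Γ ⊢ Δ) = termsR G ++ termsL Γ ++ termsL Δ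

FreshLabel : ℕ → Seq → Set
FreshLabel a s = lab (lv a) ∉ seqTerms s

NewVar : ℕ → Seq → Set
NewVar x s = var x ∉ seqTerms s

Ground : Seq → Set
Ground s = ∀ x → var x ∉ seqTerms s

-- Symbolic derivations in FVLS_BBI.
-- Γ, Δ are multisets: represented as lists, principal formulae written
-- at the front, with an explicit (constraint-free) exchange rule `perm`.

data Deriv : Seq → Set where
  id    : ∀ {G Γ Δ w₁ w₂ P} →
          Deriv (G ∥ (w₁ ∶ atom P) ∷ Γ ⊢ (w₂ ∶ atom P) ∷ Δ)
  ⊥L    : ∀ {G Γ Δ w} → Deriv (G ∥ (w ∶ ⊥f) ∷ Γ ⊢ Δ)
  ⊤R    : ∀ {G Γ Δ w} → Deriv (G ∥ Γ ⊢ (w ∶ ⊤f) ∷ Δ)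
  ⊤*R   : ∀ {G Γ Δ w} → Deriv (G ∥ Γ ⊢ (w ∶ ⊤*) ∷ Δ)
  ⊤*L   : ∀ {G Γ Δ w} →
          Deriv (⟨ lab ε , w ▷ lab ε ⟩ ∷ G ∥ Γ ⊢ Δ) →
          Deriv (G ∥ (w ∶ ⊤*) ∷ Γ ⊢ Δ)
  ∧L    : ∀ {G Γ Δ w A B} →
          Deriv (G ∥ (w ∶ A) ∷ (w ∶ B) ∷ Γ ⊢ Δ) →
          Deriv (G ∥ (w ∶ (A ∧f B)) ∷ Γ ⊢ Δ)
  ∧R    : ∀ {G Γ Δ w A B} →
          Deriv (G ∥ Γ ⊢ (w ∶ A) ∷ Δ) →
          Deriv (G ∥ Γ ⊢ (w ∶ B) ∷ Δ) →
          Deriv (G ∥ Γ ⊢ (w ∶ (A ∧f B)) ∷ Δ)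
  ⇒L    : ∀ {G Γ Δ w A B} →
          Deriv (G ∥ Γ ⊢ (w ∶ A) ∷ Δ) →
          Deriv (G ∥ (w ∶ B) ∷ Γ ⊢ Δ) →
          Deriv (G ∥ (w ∶ (A ⇒f B)) ∷ Γ ⊢ Δ)
  ⇒R    : ∀ {G Γ Δ w A B} →
          Deriv (G ∥ (w ∶ A) ∷ Γ ⊢ (w ∶ B) ∷ Δ) →
          Deriv (G ∥ Γ ⊢ (w ∶ (A ⇒f B)) ∷ Δ)
  ∗L    : ∀ {G Γ Δ w A B} (a b : ℕ) → a ≢ b →
          FreshLabel a (G ∥ (w ∶ (A ∗ B)) ∷ Γ ⊢ Δ) →
          FreshLabel b (G ∥ (w ∶ (A ∗ B)) ∷ Γ ⊢ Δ) →
          Deriv (⟨ lab (lv a) , lab (lv b) ▷ w ⟩ ∷ G ∥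
                 (lab (lv a) ∶ A) ∷ (lab (lv b) ∶ B) ∷ Γ ⊢ Δ) →
          Deriv (G ∥ (w ∶ (A ∗ B)) ∷ Γ ⊢ Δ)
  −∗R   : ∀ {G Γ Δ w A B} (a c : ℕ) → a ≢ c →
          FreshLabel a (G ∥ Γ ⊢ (w ∶ (A −∗ B)) ∷ Δ) →
          FreshLabel c (G ∥ Γ ⊢ (w ∶ (A −∗ B)) ∷ Δ) →
          Deriv (⟨ lab (lv a) , w ▷ lab (lv c) ⟩ ∷ G ∥
                 (lab (lv a) ∶ A) ∷ Γ ⊢ (lab (lv c) ∶ B) ∷ Δ) →
          Deriv (G ∥ Γ ⊢ (w ∶ (A −∗ B)) ∷ Δ)
  ∗R    : ∀ {G Γ Δ w A B} (x y : ℕ) → x ≢ y →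
          NewVar x (G ∥ Γ ⊢ (w ∶ (A ∗ B)) ∷ Δ) →
          NewVar y (G ∥ Γ ⊢ (w ∶ (A ∗ B)) ∷ Δ) →
          Deriv (G ∥ Γ ⊢ (var x ∶ A) ∷ (w ∶ (A ∗ B)) ∷ Δ) →
          Deriv (G ∥ Γ ⊢ (var y ∶ B) ∷ (w ∶ (A ∗ B)) ∷ Δ) →
          Deriv (G ∥ Γ ⊢ (w ∶ (A ∗ B)) ∷ Δ)
  −∗L   : ∀ {G Γ Δ w A B} (x z : ℕ) → x ≢ z →
          NewVar x (G ∥ (w ∶ (A −∗ B)) ∷ Γ ⊢ Δ) →
          NewVar z (G ∥ (w ∶ (A −∗ B)) ∷ Γ ⊢ Δ) →
          Deriv (G ∥ (w ∶ (A −∗ B)) ∷ Γ ⊢ (var x ∶ A) ∷ Δ) →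
          Deriv (G ∥ (var z ∶ B) ∷ (w ∶ (A −∗ B)) ∷ Γ ⊢ Δ) →
          Deriv (G ∥ (w ∶ (A −∗ B)) ∷ Γ ⊢ Δ)
  perm  : ∀ {G Γ Γ′ Δ Δ′} → Γ ↭ Γ′ → Δ ↭ Δ′ →
          Deriv (G ∥ Γ′ ⊢ Δ′) → Deriv (G ∥ Γ ⊢ Δ)

-- Free variables created by ∗R / −∗L instances of a derivation
-- (the standing assumption: these are pairwise distinct, i.e. `Unique`).
created : ∀ {s} → Deriv s → List ℕ
created id = []
created ⊥L = []
created ⊤R = []
created ⊤*R = []
created (⊤*L d) = created d
created (∧L d) = created d
created (∧R d₁ d₂) = created d₁ ++ created d₂
created (⇒L d₁ d₂) = created d₁ ++ created d₂
created (⇒R d) = created d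
created (∗L _ _ _ _ _ d) = created d
created (−∗R _ _ _ _ _ d) = created d
created (∗R x y _ _ _ d₁ d₂) = x ∷ y ∷ created d₁ ++ created d₂
created (−∗L x z _ _ _ d₁ d₂) = x ∷ z ∷ created d₁ ++ created d₂
created (perm _ _ d) = created d

data Goal : Set where
  eqG  : Term → Term → Goal
  relG : RelAtom → Goal

record Constraint : Set where
  constructor _⊢?_
  field lhs  : List RelAtom
        goal : Goal
open Constraint public

goalTerms : Goal → List Term
goalTerms (eqG u v) = u ∷ v ∷ []
goalTerms (relG r) = termsA r

constraintTerms : Constraint → List Term
constraintTerms (G ⊢? g) = termsR G ++ goalTerms g

-- C(Π): constraints indexed by the rule instances generating them.
-- CPos d = the constraint-generating rule instances (id, ⊤*R, ∗R, −∗L) of d.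

CPos : ∀ {s} → Deriv s → Set
CPos id = ⊤
CPos ⊥L = ⊥
CPos ⊤R = ⊥
CPos ⊤*R = ⊤
CPos (⊤*L d) = CPos d
CPos (∧L d) = CPos d
CPos (∧R d₁ d₂) = CPos d₁ ⊎ CPos d₂
CPos (⇒L d₁ d₂) = CPos d₁ ⊎ CPos d₂
CPos (⇒R d) = CPos d
CPos (∗L _ _ _ _ _ d) = CPos d
CPos (−∗R _ _ _ _ _ d) = CPos d
CPos (∗R _ _ _ _ _ d₁ d₂) = ⊤ ⊎ (CPos d₁ ⊎ CPos d₂)
CPos (−∗L _ _ _ _ _ d₁ d₂) = ⊤ ⊎ (CPos d₁ ⊎ CPos d₂)
CPos (perm _ _ d) = CPos d

cons : ∀ {s} (d : Deriv s) → CPos d → Constraint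
cons (id {G = G} {w₁ = w₁} {w₂ = w₂}) tt = G ⊢? eqG w₁ w₂
cons (⊤*R {G = G} {w = w}) tt = G ⊢? eqG w (lab ε)
cons (⊤*L d) p = cons d p
cons (∧L d) p = cons d p
cons (∧R d₁ d₂) (inj₁ p) = cons d₁ p
cons (∧R d₁ d₂) (inj₂ p) = cons d₂ p
cons (⇒L d₁ d₂) (inj₁ p) = cons d₁ p
cons (⇒L d₁ d₂) (inj₂ p) = cons d₂ p
cons (⇒R d) p = cons d p
cons (∗L _ _ _ _ _ d) p = cons d p
cons (−∗R _ _ _ _ _ d) p = cons d p
cons (∗R {G = G} {w = w} x y _ _ _ d₁ d₂) (inj₁ tt) = G ⊢? relG ⟨ var x , var y ▷ w ⟩
cons (∗R _ _ _ _ _ d₁ d₂) (inj₂ (inj₁ p)) = cons d₁ p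
cons (∗R _ _ _ _ _ d₁ d₂) (inj₂ (inj₂ p)) = cons d₂ p
cons (−∗L {G = G} {w = w} x z _ _ _ d₁ d₂) (inj₁ tt) = G ⊢? relG ⟨ var x , w ▷ var z ⟩
cons (−∗L _ _ _ _ _ d₁ d₂) (inj₂ (inj₁ p)) = cons d₁ p
cons (−∗L _ _ _ _ _ d₁ d₂) (inj₂ (inj₂ p)) = cons d₂ p
cons (perm _ _ d) p = cons d p

-- ⪯^Π : the conclusion of r(c₁) lies on the path from the root to the
-- conclusion of r(c₂)  (ancestor-or-equal in the derivation tree).
⪯Π : ∀ {s} (d : Deriv s) → CPos d → CPos d → Set
⪯Π id tt tt = ⊤
⪯Π ⊤*R tt tt = ⊤
⪯Π (⊤*L d) p q = ⪯Π d p q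
⪯Π (∧L d) p q = ⪯Π d p q
⪯Π (∧R d₁ d₂) (inj₁ p) (inj₁ q) = ⪯Π d₁ p q
⪯Π (∧R d₁ d₂) (inj₁ p) (inj₂ q) = ⊥
⪯Π (∧R d₁ d₂) (inj₂ p) (inj₁ q) = ⊥
⪯Π (∧R d₁ d₂) (inj₂ p) (inj₂ q) = ⪯Π d₂ p q
⪯Π (⇒L d₁ d₂) (inj₁ p) (inj₁ q) = ⪯Π d₁ p q
⪯Π (⇒L d₁ d₂) (inj₁ p) (inj₂ q) = ⊥
⪯Π (⇒L d₁ d₂) (inj₂ p) (inj₁ q) = ⊥
⪯Π (⇒L d₁ d₂) (inj₂ p) (inj₂ q) = ⪯Π d₂ p q
⪯Π (⇒R d) p q = ⪯Π d p q
⪯Π (∗L _ _ _ _ _ d) p q = ⪯Π d p q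
⪯Π (−∗R _ _ _ _ _ d) p q = ⪯Π d p q
⪯Π (∗R _ _ _ _ _ d₁ d₂) (inj₁ tt) q = ⊤
⪯Π (∗R _ _ _ _ _ d₁ d₂) (inj₂ p) (inj₁ tt) = ⊥
⪯Π (∗R _ _ _ _ _ d₁ d₂) (inj₂ (inj₁ p)) (inj₂ (inj₁ q)) = ⪯Π d₁ p q
⪯Π (∗R _ _ _ _ _ d₁ d₂) (inj₂ (inj₁ p)) (inj₂ (inj₂ q)) = ⊥
⪯Π (∗R _ _ _ _ _ d₁ d₂) (inj₂ (inj₂ p)) (inj₂ (inj₁ q)) = ⊥
⪯Π (∗R _ _ _ _ _ d₁ d₂) (inj₂ (inj₂ p)) (inj₂ (inj₂ q)) = ⪯Π d₂ p q
⪯Π (−∗L _ _ _ _ _ d₁ d₂) (inj₁ tt) q = ⊤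
⪯Π (−∗L _ _ _ _ _ d₁ d₂) (inj₂ p) (inj₁ tt) = ⊥
⪯Π (−∗L _ _ _ _ _ d₁ d₂) (inj₂ (inj₁ p)) (inj₂ (inj₁ q)) = ⪯Π d₁ p q
⪯Π (−∗L _ _ _ _ _ d₁ d₂) (inj₂ (inj₁ p)) (inj₂ (inj₂ q)) = ⊥
⪯Π (−∗L _ _ _ _ _ d₁ d₂) (inj₂ (inj₂ p)) (inj₂ (inj₁ q)) = ⊥
⪯Π (−∗L _ _ _ _ _ d₁ d₂) (inj₂ (inj₂ p)) (inj₂ (inj₂ q)) = ⪯Π d₂ p q
⪯Π (perm _ _ d) p q = ⪯Π d p q

module _ {I : Set} (c : I → Constraint) (_⪯_ : I → I → Set) where

  _≺_ : I → I → Set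
  p ≺ q = p ⪯ q × p ≢ q

  record IsConstraintSystem : Set₁ where
    field
      isPartialOrder : IsPartialOrder _≡_ _⪯_
      wellFounded    : WellFounded _≺_
      monotone       : ∀ {p q} → p ⪯ q → lhs (c p) ⊆ lhs (c q)

  RelIntro : ℕ → I → Set
  RelIntro x p = Σ RelAtom λ r → goal (c p) ≡ relG r ×
                 var x ∈ termsA r × var x ∉ termsR (lhs (c p))

  Origin : ℕ → I → Set
  Origin x p = RelIntro x p ×
               (∀ q → RelIntro x q → p ⪯ q) ×
               (∀ q → q ≺ p → var x ∉ constraintTerms (c q))

  IsWellFormed : Set
  IsWellFormed = ∀ x → (∃[ p ] var x ∈ constraintTerms (c p)) →
                 ∃[ p ] (Origin x p × (∀ p′ → Origin x p′ → p′ ≡ p))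

-- The positions of the constraints of Π are the id, ⊤*R, ∗R and −∗L instances, and ⪯Π is their
-- ancestor order in the derivation tree. A proper ancestor lies strictly closer to the root,
-- so the order is antisymmetric and well-founded, and since rules only ever add relational
-- atoms when read upwards, the left-hand side of a constraint contains those of all its
-- ancestors. If the root is ground, a free variable can enter the derivation only at the ∗R or
-- −∗L instance creating it, whose conclusion it does not occur in; hence every constraint that
-- mentions it lies above that instance, the instance's own relational constraint is its
-- unique origin, and distinctness of the created variables keeps sibling subtrees from
-- sharing it.
module Submission where

open import Defs
open import Data.Empty using (⊥-elim)
open import Data.List using (List; []; _∷_; _++_)
open import Data.List.Membership.Propositional using (_∈_; _∉_)
open import Data.List.Membership.Propositional.Properties using (∈-++⁺ˡ; ∈-++⁺ʳ)
open import Data.List.Relation.Binary.Disjoint.Propositional using (Disjoint)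
open import Data.List.Relation.Binary.Permutation.Propositional.Properties using (All-resp-↭; map⁺)
open import Data.List.Relation.Binary.Subset.Propositional using (_⊆_)
open import Data.List.Relation.Unary.All using (All; []; _∷_; lookup)
open import Data.List.Relation.Unary.All.Properties using (¬Any⇒All¬; All¬⇒¬Any; ++⁺; ++⁻; ++⁻ˡ; ++⁻ʳ)
open import Data.List.Relation.Unary.AllPairs using ([]; _∷_)
open import Data.List.Relation.Unary.Any using (here; there)
open import Data.List.Relation.Unary.Unique.Propositional using (Unique)
open import Data.Nat using (ℕ; zero; suc; _<_; z<s; s<s; _≟_)
open import Data.Nat.Induction using (<-wellFounded)
open import Data.Nat.Properties using (<-asym)
open import Data.Product using (_×_; ∃-syntax; _,_; proj₁)
open import Data.Sum using (_⊎_; inj₁; inj₂; [_,_]) renaming (map₁ to ⊎-map₁; map to ⊎-map)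
open import Data.Unit using (tt)
open import Function using (_∘_; const)
open import Induction.WellFounded using (WellFounded; module Subrelation)
open import Relation.Binary.Construct.On as On using ()
open import Relation.Binary.PropositionalEquality using (_≡_; _≢_; refl; sym; cong; subst; isEquivalence)
open import Relation.Binary.Structures using (IsPartialOrder)
open import Relation.Nullary using (¬_; yes; no; contradiction)

⪯Π-refl : ∀ {s} (d : Deriv s) p → ⪯Π d p p
⪯Π-refl id tt = tt
⪯Π-refl ⊤*R tt = tt
⪯Π-refl (⊤*L d) p = ⪯Π-refl d p
⪯Π-refl (∧L d) p = ⪯Π-refl d p
⪯Π-refl (∧R d₁ d₂) (inj₁ p) = ⪯Π-refl d₁ p
⪯Π-refl (∧R d₁ d₂) (inj₂ p) = ⪯Π-refl d₂ p
⪯Π-refl (⇒L d₁ d₂) (inj₁ p) = ⪯Π-refl d₁ p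
⪯Π-refl (⇒L d₁ d₂) (inj₂ p) = ⪯Π-refl d₂ p
⪯Π-refl (⇒R d) p = ⪯Π-refl d p
⪯Π-refl (∗L _ _ _ _ _ d) p = ⪯Π-refl d p
⪯Π-refl (−∗R _ _ _ _ _ d) p = ⪯Π-refl d p
⪯Π-refl (∗R _ _ _ _ _ d₁ d₂) (inj₁ tt) = tt
⪯Π-refl (∗R _ _ _ _ _ d₁ d₂) (inj₂ (inj₁ p)) = ⪯Π-refl d₁ p
⪯Π-refl (∗R _ _ _ _ _ d₁ d₂) (inj₂ (inj₂ p)) = ⪯Π-refl d₂ p
⪯Π-refl (−∗L _ _ _ _ _ d₁ d₂) (inj₁ tt) = tt
⪯Π-refl (−∗L _ _ _ _ _ d₁ d₂) (inj₂ (inj₁ p)) = ⪯Π-refl d₁ p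
⪯Π-refl (−∗L _ _ _ _ _ d₁ d₂) (inj₂ (inj₂ p)) = ⪯Π-refl d₂ p
⪯Π-refl (perm _ _ d) p = ⪯Π-refl d p

⪯Π-trans : ∀ {s} (d : Deriv s) p q r → ⪯Π d p q → ⪯Π d q r → ⪯Π d p r
⪯Π-trans id tt tt tt _ _ = tt
⪯Π-trans ⊤*R tt tt tt _ _ = tt
⪯Π-trans (⊤*L d) = ⪯Π-trans d
⪯Π-trans (∧L d) = ⪯Π-trans d
⪯Π-trans (∧R d₁ d₂) (inj₁ p) (inj₁ q) (inj₁ r) = ⪯Π-trans d₁ p q r
⪯Π-trans (∧R d₁ d₂) (inj₂ p) (inj₂ q) (inj₂ r) = ⪯Π-trans d₂ p q r
⪯Π-trans (∧R d₁ d₂) (inj₁ _) (inj₁ _) (inj₂ _) _ ()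
⪯Π-trans (∧R d₁ d₂) (inj₂ _) (inj₂ _) (inj₁ _) _ ()
⪯Π-trans (∧R d₁ d₂) (inj₁ _) (inj₂ _) _ ()
⪯Π-trans (∧R d₁ d₂) (inj₂ _) (inj₁ _) _ ()
⪯Π-trans (⇒L d₁ d₂) (inj₁ p) (inj₁ q) (inj₁ r) = ⪯Π-trans d₁ p q r
⪯Π-trans (⇒L d₁ d₂) (inj₂ p) (inj₂ q) (inj₂ r) = ⪯Π-trans d₂ p q r
⪯Π-trans (⇒L d₁ d₂) (inj₁ _) (inj₁ _) (inj₂ _) _ ()
⪯Π-trans (⇒L d₁ d₂) (inj₂ _) (inj₂ _) (inj₁ _) _ ()
⪯Π-trans (⇒L d₁ d₂) (inj₁ _) (inj₂ _) _ ()
⪯Π-trans (⇒L d₁ d₂) (inj₂ _) (inj₁ _) _ ()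
⪯Π-trans (⇒R d) = ⪯Π-trans d
⪯Π-trans (∗L _ _ _ _ _ d) = ⪯Π-trans d
⪯Π-trans (−∗R _ _ _ _ _ d) = ⪯Π-trans d
⪯Π-trans (∗R _ _ _ _ _ d₁ d₂) (inj₁ tt) _ _ _ _ = tt
⪯Π-trans (∗R _ _ _ _ _ d₁ d₂) (inj₂ _) (inj₁ tt) _ ()
⪯Π-trans (∗R _ _ _ _ _ d₁ d₂) (inj₂ _) (inj₂ _) (inj₁ tt) _ ()
⪯Π-trans (∗R _ _ _ _ _ d₁ d₂) (inj₂ (inj₁ p)) (inj₂ (inj₁ q)) (inj₂ (inj₁ r)) = ⪯Π-trans d₁ p q r
⪯Π-trans (∗R _ _ _ _ _ d₁ d₂) (inj₂ (inj₂ p)) (inj₂ (inj₂ q)) (inj₂ (inj₂ r)) = ⪯Π-trans d₂ p q r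
⪯Π-trans (∗R _ _ _ _ _ d₁ d₂) (inj₂ (inj₁ _)) (inj₂ (inj₁ _)) (inj₂ (inj₂ _)) _ ()
⪯Π-trans (∗R _ _ _ _ _ d₁ d₂) (inj₂ (inj₂ _)) (inj₂ (inj₂ _)) (inj₂ (inj₁ _)) _ ()
⪯Π-trans (∗R _ _ _ _ _ d₁ d₂) (inj₂ (inj₁ _)) (inj₂ (inj₂ _)) _ ()
⪯Π-trans (∗R _ _ _ _ _ d₁ d₂) (inj₂ (inj₂ _)) (inj₂ (inj₁ _)) _ ()
⪯Π-trans (−∗L _ _ _ _ _ d₁ d₂) (inj₁ tt) _ _ _ _ = tt
⪯Π-trans (−∗L _ _ _ _ _ d₁ d₂) (inj₂ _) (inj₁ tt) _ ()
⪯Π-trans (−∗L _ _ _ _ _ d₁ d₂) (inj₂ _) (inj₂ _) (inj₁ tt) _ ()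
⪯Π-trans (−∗L _ _ _ _ _ d₁ d₂) (inj₂ (inj₁ p)) (inj₂ (inj₁ q)) (inj₂ (inj₁ r)) = ⪯Π-trans d₁ p q r
⪯Π-trans (−∗L _ _ _ _ _ d₁ d₂) (inj₂ (inj₂ p)) (inj₂ (inj₂ q)) (inj₂ (inj₂ r)) = ⪯Π-trans d₂ p q r
⪯Π-trans (−∗L _ _ _ _ _ d₁ d₂) (inj₂ (inj₁ _)) (inj₂ (inj₁ _)) (inj₂ (inj₂ _)) _ ()
⪯Π-trans (−∗L _ _ _ _ _ d₁ d₂) (inj₂ (inj₂ _)) (inj₂ (inj₂ _)) (inj₂ (inj₁ _)) _ ()
⪯Π-trans (−∗L _ _ _ _ _ d₁ d₂) (inj₂ (inj₁ _)) (inj₂ (inj₂ _)) _ ()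
⪯Π-trans (−∗L _ _ _ _ _ d₁ d₂) (inj₂ (inj₂ _)) (inj₂ (inj₁ _)) _ ()
⪯Π-trans (perm _ _ d) = ⪯Π-trans d

-- The number of proper ancestors of a position in the order ⪯Π.
depth : ∀ {s} (d : Deriv s) → CPos d → ℕ
depth id _ = zero
depth ⊤*R _ = zero
depth (⊤*L d) = depth d
depth (∧L d) = depth d
depth (∧R d₁ d₂) = [ depth d₁ , depth d₂ ]
depth (⇒L d₁ d₂) = [ depth d₁ , depth d₂ ]
depth (⇒R d) = depth d
depth (∗L _ _ _ _ _ d) = depth d
depth (−∗R _ _ _ _ _ d) = depth d
depth (∗R _ _ _ _ _ d₁ d₂) = [ const zero , suc ∘ [ depth d₁ , depth d₂ ] ]
depth (−∗L _ _ _ _ _ d₁ d₂) = [ const zero , suc ∘ [ depth d₁ , depth d₂ ] ]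
depth (perm _ _ d) = depth d

⪯Π⇒≡⊎depth< : ∀ {s} (d : Deriv s) p q → ⪯Π d p q → p ≡ q ⊎ depth d p < depth d q
⪯Π⇒≡⊎depth< id tt tt _ = inj₁ refl
⪯Π⇒≡⊎depth< ⊤*R tt tt _ = inj₁ refl
⪯Π⇒≡⊎depth< (⊤*L d) = ⪯Π⇒≡⊎depth< d
⪯Π⇒≡⊎depth< (∧L d) = ⪯Π⇒≡⊎depth< d
⪯Π⇒≡⊎depth< (∧R d₁ d₂) (inj₁ p) (inj₁ q) = ⊎-map₁ (cong inj₁) ∘ ⪯Π⇒≡⊎depth< d₁ p q
⪯Π⇒≡⊎depth< (∧R d₁ d₂) (inj₂ p) (inj₂ q) = ⊎-map₁ (cong inj₂) ∘ ⪯Π⇒≡⊎depth< d₂ p q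
⪯Π⇒≡⊎depth< (∧R d₁ d₂) (inj₁ _) (inj₂ _) ()
⪯Π⇒≡⊎depth< (∧R d₁ d₂) (inj₂ _) (inj₁ _) ()
⪯Π⇒≡⊎depth< (⇒L d₁ d₂) (inj₁ p) (inj₁ q) = ⊎-map₁ (cong inj₁) ∘ ⪯Π⇒≡⊎depth< d₁ p q
⪯Π⇒≡⊎depth< (⇒L d₁ d₂) (inj₂ p) (inj₂ q) = ⊎-map₁ (cong inj₂) ∘ ⪯Π⇒≡⊎depth< d₂ p q
⪯Π⇒≡⊎depth< (⇒L d₁ d₂) (inj₁ _) (inj₂ _) ()
⪯Π⇒≡⊎depth< (⇒L d₁ d₂) (inj₂ _) (inj₁ _) ()
⪯Π⇒≡⊎depth< (⇒R d) = ⪯Π⇒≡⊎depth< d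
⪯Π⇒≡⊎depth< (∗L _ _ _ _ _ d) = ⪯Π⇒≡⊎depth< d
⪯Π⇒≡⊎depth< (−∗R _ _ _ _ _ d) = ⪯Π⇒≡⊎depth< d
⪯Π⇒≡⊎depth< (∗R _ _ _ _ _ d₁ d₂) (inj₁ tt) (inj₁ tt) _ = inj₁ refl
⪯Π⇒≡⊎depth< (∗R _ _ _ _ _ d₁ d₂) (inj₁ tt) (inj₂ _) _ = inj₂ z<s
⪯Π⇒≡⊎depth< (∗R _ _ _ _ _ d₁ d₂) (inj₂ _) (inj₁ tt) ()
⪯Π⇒≡⊎depth< (∗R _ _ _ _ _ d₁ d₂) (inj₂ (inj₁ p)) (inj₂ (inj₁ q)) =
  ⊎-map (cong (inj₂ ∘ inj₁)) s<s ∘ ⪯Π⇒≡⊎depth< d₁ p q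
⪯Π⇒≡⊎depth< (∗R _ _ _ _ _ d₁ d₂) (inj₂ (inj₂ p)) (inj₂ (inj₂ q)) =
  ⊎-map (cong (inj₂ ∘ inj₂)) s<s ∘ ⪯Π⇒≡⊎depth< d₂ p q
⪯Π⇒≡⊎depth< (∗R _ _ _ _ _ d₁ d₂) (inj₂ (inj₁ _)) (inj₂ (inj₂ _)) ()
⪯Π⇒≡⊎depth< (∗R _ _ _ _ _ d₁ d₂) (inj₂ (inj₂ _)) (inj₂ (inj₁ _)) ()
⪯Π⇒≡⊎depth< (−∗L _ _ _ _ _ d₁ d₂) (inj₁ tt) (inj₁ tt) _ = inj₁ refl
⪯Π⇒≡⊎depth< (−∗L _ _ _ _ _ d₁ d₂) (inj₁ tt) (inj₂ _) _ = inj₂ z<s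
⪯Π⇒≡⊎depth< (−∗L _ _ _ _ _ d₁ d₂) (inj₂ _) (inj₁ tt) ()
⪯Π⇒≡⊎depth< (−∗L _ _ _ _ _ d₁ d₂) (inj₂ (inj₁ p)) (inj₂ (inj₁ q)) =
  ⊎-map (cong (inj₂ ∘ inj₁)) s<s ∘ ⪯Π⇒≡⊎depth< d₁ p q
⪯Π⇒≡⊎depth< (−∗L _ _ _ _ _ d₁ d₂) (inj₂ (inj₂ p)) (inj₂ (inj₂ q)) =
  ⊎-map (cong (inj₂ ∘ inj₂)) s<s ∘ ⪯Π⇒≡⊎depth< d₂ p q
⪯Π⇒≡⊎depth< (−∗L _ _ _ _ _ d₁ d₂) (inj₂ (inj₁ _)) (inj₂ (inj₂ _)) ()
⪯Π⇒≡⊎depth< (−∗L _ _ _ _ _ d₁ d₂) (inj₂ (inj₂ _)) (inj₂ (inj₁ _)) ()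
⪯Π⇒≡⊎depth< (perm _ _ d) = ⪯Π⇒≡⊎depth< d

⪯Π-antisym : ∀ {s} (d : Deriv s) p q → ⪯Π d p q → ⪯Π d q p → p ≡ q
⪯Π-antisym d p q p⪯q q⪯p with ⪯Π⇒≡⊎depth< d p q p⪯q | ⪯Π⇒≡⊎depth< d q p q⪯p
... | inj₁ p≡q | _ = p≡q
... | inj₂ _ | inj₁ q≡p = sym q≡p
... | inj₂ p<q | inj₂ q<p = ⊥-elim (<-asym p<q q<p)

⪯Π-isPartialOrder : ∀ {s} (d : Deriv s) → IsPartialOrder _≡_ (⪯Π d)
⪯Π-isPartialOrder d = record
  { isPreorder = record
    { isEquivalence = isEquivalence
    ; reflexive = λ { {p} refl → ⪯Π-refl d p }
    ; trans = λ {p} {q} {r} → ⪯Π-trans d p q r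
    }
  ; antisym = λ {p} {q} → ⪯Π-antisym d p q
  }

≺Π⇒depth< : ∀ {s} (d : Deriv s) {p q} → _≺_ (cons d) (⪯Π d) p q → depth d p < depth d q
≺Π⇒depth< d {p} {q} (p⪯q , p≢q) with ⪯Π⇒≡⊎depth< d p q p⪯q
... | inj₁ p≡q = contradiction p≡q p≢q
... | inj₂ p<q = p<q

≺Π-wellFounded : ∀ {s} (d : Deriv s) → WellFounded (_≺_ (cons d) (⪯Π d))
≺Π-wellFounded d =
  Subrelation.wellFounded (≺Π⇒depth< d) (On.wellFounded (depth d) <-wellFounded)

relAtoms : Seq → List RelAtom
relAtoms (G ∥ _ ⊢ _) = G

relAtoms⊆lhs : ∀ {s} (d : Deriv s) p → relAtoms s ⊆ lhs (cons d p)
relAtoms⊆lhs id tt = λ r∈G → r∈G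
relAtoms⊆lhs ⊤*R tt = λ r∈G → r∈G
relAtoms⊆lhs (⊤*L d) p = relAtoms⊆lhs d p ∘ there
relAtoms⊆lhs (∧L d) p = relAtoms⊆lhs d p
relAtoms⊆lhs (∧R d₁ d₂) (inj₁ p) = relAtoms⊆lhs d₁ p
relAtoms⊆lhs (∧R d₁ d₂) (inj₂ p) = relAtoms⊆lhs d₂ p
relAtoms⊆lhs (⇒L d₁ d₂) (inj₁ p) = relAtoms⊆lhs d₁ p
relAtoms⊆lhs (⇒L d₁ d₂) (inj₂ p) = relAtoms⊆lhs d₂ p
relAtoms⊆lhs (⇒R d) p = relAtoms⊆lhs d p
relAtoms⊆lhs (∗L _ _ _ _ _ d) p = relAtoms⊆lhs d p ∘ there
relAtoms⊆lhs (−∗R _ _ _ _ _ d) p = relAtoms⊆lhs d p ∘ there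
relAtoms⊆lhs (∗R _ _ _ _ _ d₁ d₂) (inj₁ tt) = λ r∈G → r∈G
relAtoms⊆lhs (∗R _ _ _ _ _ d₁ d₂) (inj₂ (inj₁ p)) = relAtoms⊆lhs d₁ p
relAtoms⊆lhs (∗R _ _ _ _ _ d₁ d₂) (inj₂ (inj₂ p)) = relAtoms⊆lhs d₂ p
relAtoms⊆lhs (−∗L _ _ _ _ _ d₁ d₂) (inj₁ tt) = λ r∈G → r∈G
relAtoms⊆lhs (−∗L _ _ _ _ _ d₁ d₂) (inj₂ (inj₁ p)) = relAtoms⊆lhs d₁ p
relAtoms⊆lhs (−∗L _ _ _ _ _ d₁ d₂) (inj₂ (inj₂ p)) = relAtoms⊆lhs d₂ p
relAtoms⊆lhs (perm _ _ d) p = relAtoms⊆lhs d p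

⪯Π-monotone : ∀ {s} (d : Deriv s) p q → ⪯Π d p q → lhs (cons d p) ⊆ lhs (cons d q)
⪯Π-monotone id tt tt _ = λ r∈G → r∈G
⪯Π-monotone ⊤*R tt tt _ = λ r∈G → r∈G
⪯Π-monotone (⊤*L d) = ⪯Π-monotone d
⪯Π-monotone (∧L d) = ⪯Π-monotone d
⪯Π-monotone (∧R d₁ d₂) (inj₁ p) (inj₁ q) = ⪯Π-monotone d₁ p q
⪯Π-monotone (∧R d₁ d₂) (inj₂ p) (inj₂ q) = ⪯Π-monotone d₂ p q
⪯Π-monotone (∧R d₁ d₂) (inj₁ _) (inj₂ _) ()
⪯Π-monotone (∧R d₁ d₂) (inj₂ _) (inj₁ _) ()
⪯Π-monotone (⇒L d₁ d₂) (inj₁ p) (inj₁ q) = ⪯Π-monotone d₁ p q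
⪯Π-monotone (⇒L d₁ d₂) (inj₂ p) (inj₂ q) = ⪯Π-monotone d₂ p q
⪯Π-monotone (⇒L d₁ d₂) (inj₁ _) (inj₂ _) ()
⪯Π-monotone (⇒L d₁ d₂) (inj₂ _) (inj₁ _) ()
⪯Π-monotone (⇒R d) = ⪯Π-monotone d
⪯Π-monotone (∗L _ _ _ _ _ d) = ⪯Π-monotone d
⪯Π-monotone (−∗R _ _ _ _ _ d) = ⪯Π-monotone d
⪯Π-monotone d@(∗R _ _ _ _ _ _ _) (inj₁ tt) q _ = relAtoms⊆lhs d q
⪯Π-monotone (∗R _ _ _ _ _ d₁ d₂) (inj₂ _) (inj₁ tt) ()
⪯Π-monotone (∗R _ _ _ _ _ d₁ d₂) (inj₂ (inj₁ p)) (inj₂ (inj₁ q)) = ⪯Π-monotone d₁ p q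
⪯Π-monotone (∗R _ _ _ _ _ d₁ d₂) (inj₂ (inj₂ p)) (inj₂ (inj₂ q)) = ⪯Π-monotone d₂ p q
⪯Π-monotone (∗R _ _ _ _ _ d₁ d₂) (inj₂ (inj₁ _)) (inj₂ (inj₂ _)) ()
⪯Π-monotone (∗R _ _ _ _ _ d₁ d₂) (inj₂ (inj₂ _)) (inj₂ (inj₁ _)) ()
⪯Π-monotone d@(−∗L _ _ _ _ _ _ _) (inj₁ tt) q _ = relAtoms⊆lhs d q
⪯Π-monotone (−∗L _ _ _ _ _ d₁ d₂) (inj₂ _) (inj₁ tt) ()
⪯Π-monotone (−∗L _ _ _ _ _ d₁ d₂) (inj₂ (inj₁ p)) (inj₂ (inj₁ q)) = ⪯Π-monotone d₁ p q
⪯Π-monotone (−∗L _ _ _ _ _ d₁ d₂) (inj₂ (inj₂ p)) (inj₂ (inj₂ q)) = ⪯Π-monotone d₂ p q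
⪯Π-monotone (−∗L _ _ _ _ _ d₁ d₂) (inj₂ (inj₁ _)) (inj₂ (inj₂ _)) ()
⪯Π-monotone (−∗L _ _ _ _ _ d₁ d₂) (inj₂ (inj₂ _)) (inj₂ (inj₁ _)) ()
⪯Π-monotone (perm _ _ d) = ⪯Π-monotone d

isConstraintSystem : ∀ {s} (d : Deriv s) → IsConstraintSystem (cons d) (⪯Π d)
isConstraintSystem d = record
  { isPartialOrder = ⪯Π-isPartialOrder d
  ; wellFounded = ≺Π-wellFounded d
  ; monotone = λ {p} {q} → ⪯Π-monotone d p q
  }

Unique-++⁻ : ∀ xs {ys : List ℕ} → Unique (xs ++ ys) → Unique xs × Unique ys × Disjoint xs ys
Unique-++⁻ [] u = [] , u , λ ()
Unique-++⁻ (x ∷ xs) (x∉ ∷ u) with Unique-++⁻ xs u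
... | uxs , uys , xs#ys = ++⁻ˡ xs x∉ ∷ uxs , uys , λ
  { (here refl , x∈ys) → lookup (++⁻ʳ xs x∉) x∈ys refl
  ; (there v∈xs , v∈ys) → xs#ys (v∈xs , v∈ys)
  }

Absent : ℕ → Seq → Set
Absent x (G ∥ Γ ⊢ Δ) =
  All (var x ≢_) (termsR G) × All (var x ≢_) (termsL Γ) × All (var x ≢_) (termsL Δ)

∉⇒Absent : ∀ {x} s → var x ∉ seqTerms s → Absent x s
∉⇒Absent (G ∥ Γ ⊢ Δ) x∉s with ++⁻ (termsR G) (¬Any⇒All¬ _ x∉s)
... | x∉G , x∉ΓΔ = x∉G , ++⁻ (termsL Γ) x∉ΓΔ

var≢ : ∀ {x y} → x ≢ y → var x ≢ var y
var≢ x≢y refl = x≢y refl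

Occurs : ∀ {s} (d : Deriv s) → ℕ → CPos d → Set
Occurs d x p = var x ∈ constraintTerms (cons d p)

relIntro⇒occurs : ∀ {s} (d : Deriv s) {x q} → RelIntro (cons d) (⪯Π d) x q → Occurs d x q
relIntro⇒occurs d {x} {q} (r , goal≡r , x∈r , _) =
  ∈-++⁺ʳ (termsR (lhs (cons d q))) (subst (λ g → var x ∈ goalTerms g) (sym goal≡r) x∈r)

Introduces : ∀ {s} (d : Deriv s) → ℕ → CPos d → Set
Introduces d x o = RelIntro (cons d) (⪯Π d) x o × (∀ q → Occurs d x q → ⪯Π d o q)

occurrence⇒introduction : ∀ {s} (d : Deriv s) {x} → Unique (created d) → Absent x s →
               ∀ p → Occurs d x p → x ∈ created d × ∃[ o ] Introduces d x o
occurrence⇒introduction id _ (x∉G , w₁ ∷ _ , w₂ ∷ _) tt = ⊥-elim ∘ All¬⇒¬Any (++⁺ x∉G (w₁ ∷ w₂ ∷ []))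
occurrence⇒introduction ⊤*R _ (x∉G , _ , w ∷ _) tt = ⊥-elim ∘ All¬⇒¬Any (++⁺ x∉G (w ∷ (λ ()) ∷ []))
occurrence⇒introduction (⊤*L d) u (x∉G , w ∷ x∉Γ , x∉Δ) =
  occurrence⇒introduction d u ((λ ()) ∷ w ∷ (λ ()) ∷ x∉G , x∉Γ , x∉Δ)
occurrence⇒introduction (∧L d) u (x∉G , w ∷ x∉Γ , x∉Δ) = occurrence⇒introduction d u (x∉G , w ∷ w ∷ x∉Γ , x∉Δ)
occurrence⇒introduction (⇒R d) u (x∉G , x∉Γ , w ∷ x∉Δ) = occurrence⇒introduction d u (x∉G , w ∷ x∉Γ , w ∷ x∉Δ)
occurrence⇒introduction (∗L _ _ _ _ _ d) u (x∉G , w ∷ x∉Γ , x∉Δ) =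
  occurrence⇒introduction d u ((λ ()) ∷ (λ ()) ∷ w ∷ x∉G , (λ ()) ∷ (λ ()) ∷ x∉Γ , x∉Δ)
occurrence⇒introduction (−∗R _ _ _ _ _ d) u (x∉G , x∉Γ , w ∷ x∉Δ) =
  occurrence⇒introduction d u ((λ ()) ∷ w ∷ (λ ()) ∷ x∉G , (λ ()) ∷ x∉Γ , (λ ()) ∷ x∉Δ)
occurrence⇒introduction (perm Γ↭ Δ↭ d) u (x∉G , x∉Γ , x∉Δ) =
  occurrence⇒introduction d u (x∉G , All-resp-↭ (map⁺ LForm.lbl Γ↭) x∉Γ , All-resp-↭ (map⁺ LForm.lbl Δ↭) x∉Δ)
occurrence⇒introduction D@(∧R d₁ d₂) {x} u x∉s = fromPremises (Unique-++⁻ (created d₁) u)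
  where
  fromPremises : Unique (created d₁) × Unique (created d₂) × Disjoint (created d₁) (created d₂) →
                 ∀ p → Occurs D x p → x ∈ created D × ∃[ o ] Introduces D x o
  fromPremises (u₁ , u₂ , d₁#d₂) (inj₁ p) occ =
    let x∈₁ , o , intro , precedes = occurrence⇒introduction d₁ u₁ x∉s p occ in
    ∈-++⁺ˡ x∈₁ , inj₁ o , intro , λ
      { (inj₁ q) → precedes q
      ; (inj₂ q) occ₂ → ⊥-elim (d₁#d₂ (x∈₁ , proj₁ (occurrence⇒introduction d₂ u₂ x∉s q occ₂))) }
  fromPremises (u₁ , u₂ , d₁#d₂) (inj₂ p) occ =
    let x∈₂ , o , intro , precedes = occurrence⇒introduction d₂ u₂ x∉s p occ in
    ∈-++⁺ʳ (created d₁) x∈₂ , inj₂ o , intro , λ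
      { (inj₂ q) → precedes q
      ; (inj₁ q) occ₁ → ⊥-elim (d₁#d₂ (proj₁ (occurrence⇒introduction d₁ u₁ x∉s q occ₁) , x∈₂)) }
occurrence⇒introduction D@(⇒L {G} {Γ} {Δ} {w} {A} {B} d₁ d₂) {x} u (x∉G , x∉w ∷ x∉Γ , x∉Δ) =
  fromPremises (Unique-++⁻ (created d₁) u)
  where
  x∉s₁ : Absent x (G ∥ Γ ⊢ (w ∶ A) ∷ Δ)
  x∉s₁ = x∉G , x∉Γ , x∉w ∷ x∉Δ
  x∉s₂ : Absent x (G ∥ (w ∶ B) ∷ Γ ⊢ Δ)
  x∉s₂ = x∉G , x∉w ∷ x∉Γ , x∉Δ
  fromPremises : Unique (created d₁) × Unique (created d₂) × Disjoint (created d₁) (created d₂) →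
                 ∀ p → Occurs D x p → x ∈ created D × ∃[ o ] Introduces D x o
  fromPremises (u₁ , u₂ , d₁#d₂) (inj₁ p) occ =
    let x∈₁ , o , intro , precedes = occurrence⇒introduction d₁ u₁ x∉s₁ p occ in
    ∈-++⁺ˡ x∈₁ , inj₁ o , intro , λ
      { (inj₁ q) → precedes q
      ; (inj₂ q) occ₂ → ⊥-elim (d₁#d₂ (x∈₁ , proj₁ (occurrence⇒introduction d₂ u₂ x∉s₂ q occ₂))) }
  fromPremises (u₁ , u₂ , d₁#d₂) (inj₂ p) occ =
    let x∈₂ , o , intro , precedes = occurrence⇒introduction d₂ u₂ x∉s₂ p occ in
    ∈-++⁺ʳ (created d₁) x∈₂ , inj₂ o , intro , λ
      { (inj₂ q) → precedes q
      ; (inj₁ q) occ₁ → ⊥-elim (d₁#d₂ (proj₁ (occurrence⇒introduction d₁ u₁ x∉s₁ q occ₁) , x∈₂)) }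
occurrence⇒introduction D@(∗R {G} {Γ} {Δ} {w} {A} {B} x′ y′ _ _ _ d₁ d₂) {x} (_ ∷ _ ∷ u)
             (x∉G , x∉Γ , x∉Δ@(x∉w ∷ _)) p occ with x ≟ x′ | x ≟ y′
... | yes refl | _ = here refl , inj₁ tt , (_ , refl , here refl , All¬⇒¬Any x∉G) , λ _ _ → tt
... | no _ | yes refl =
  there (here refl) , inj₁ tt , (_ , refl , there (here refl) , All¬⇒¬Any x∉G) , λ _ _ → tt
... | no x≢x′ | no x≢y′ = fromPremises (Unique-++⁻ (created d₁) u) p occ
  where
  x∉root : ¬ Occurs D x (inj₁ tt)
  x∉root = All¬⇒¬Any (++⁺ x∉G (var≢ x≢x′ ∷ var≢ x≢y′ ∷ x∉w ∷ []))
  x∉s₁ : Absent x (G ∥ Γ ⊢ (var x′ ∶ A) ∷ (w ∶ A ∗ B) ∷ Δ)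
  x∉s₁ = x∉G , x∉Γ , var≢ x≢x′ ∷ x∉Δ
  x∉s₂ : Absent x (G ∥ Γ ⊢ (var y′ ∶ B) ∷ (w ∶ A ∗ B) ∷ Δ)
  x∉s₂ = x∉G , x∉Γ , var≢ x≢y′ ∷ x∉Δ
  fromPremises : Unique (created d₁) × Unique (created d₂) × Disjoint (created d₁) (created d₂) →
                 ∀ p → Occurs D x p → x ∈ created D × ∃[ o ] Introduces D x o
  fromPremises _ (inj₁ tt) occ = ⊥-elim (x∉root occ)
  fromPremises (u₁ , u₂ , d₁#d₂) (inj₂ (inj₁ p)) occ =
    let x∈₁ , o , intro , precedes = occurrence⇒introduction d₁ u₁ x∉s₁ p occ in
    there (there (∈-++⁺ˡ x∈₁)) , inj₂ (inj₁ o) , intro , λ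
      { (inj₁ tt) → ⊥-elim ∘ x∉root
      ; (inj₂ (inj₁ q)) → precedes q
      ; (inj₂ (inj₂ q)) occ₂ → ⊥-elim (d₁#d₂ (x∈₁ , proj₁ (occurrence⇒introduction d₂ u₂ x∉s₂ q occ₂))) }
  fromPremises (u₁ , u₂ , d₁#d₂) (inj₂ (inj₂ p)) occ =
    let x∈₂ , o , intro , precedes = occurrence⇒introduction d₂ u₂ x∉s₂ p occ in
    there (there (∈-++⁺ʳ (created d₁) x∈₂)) , inj₂ (inj₂ o) , intro , λ
      { (inj₁ tt) → ⊥-elim ∘ x∉root
      ; (inj₂ (inj₂ q)) → precedes q
      ; (inj₂ (inj₁ q)) occ₁ → ⊥-elim (d₁#d₂ (proj₁ (occurrence⇒introduction d₁ u₁ x∉s₁ q occ₁) , x∈₂)) }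
occurrence⇒introduction D@(−∗L {G} {Γ} {Δ} {w} {A} {B} x′ z′ _ _ _ d₁ d₂) {x} (_ ∷ _ ∷ u)
             (x∉G , x∉Γ@(x∉w ∷ _) , x∉Δ) p occ with x ≟ x′ | x ≟ z′
... | yes refl | _ = here refl , inj₁ tt , (_ , refl , here refl , All¬⇒¬Any x∉G) , λ _ _ → tt
... | no _ | yes refl =
  there (here refl) , inj₁ tt , (_ , refl , there (there (here refl)) , All¬⇒¬Any x∉G) , λ _ _ → tt
... | no x≢x′ | no x≢z′ = fromPremises (Unique-++⁻ (created d₁) u) p occ
  where
  x∉root : ¬ Occurs D x (inj₁ tt)
  x∉root = All¬⇒¬Any (++⁺ x∉G (var≢ x≢x′ ∷ x∉w ∷ var≢ x≢z′ ∷ []))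
  x∉s₁ : Absent x (G ∥ (w ∶ A −∗ B) ∷ Γ ⊢ (var x′ ∶ A) ∷ Δ)
  x∉s₁ = x∉G , x∉Γ , var≢ x≢x′ ∷ x∉Δ
  x∉s₂ : Absent x (G ∥ (var z′ ∶ B) ∷ (w ∶ A −∗ B) ∷ Γ ⊢ Δ)
  x∉s₂ = x∉G , var≢ x≢z′ ∷ x∉Γ , x∉Δ
  fromPremises : Unique (created d₁) × Unique (created d₂) × Disjoint (created d₁) (created d₂) →
                 ∀ p → Occurs D x p → x ∈ created D × ∃[ o ] Introduces D x o
  fromPremises _ (inj₁ tt) occ = ⊥-elim (x∉root occ)
  fromPremises (u₁ , u₂ , d₁#d₂) (inj₂ (inj₁ p)) occ =
    let x∈₁ , o , intro , precedes = occurrence⇒introduction d₁ u₁ x∉s₁ p occ in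
    there (there (∈-++⁺ˡ x∈₁)) , inj₂ (inj₁ o) , intro , λ
      { (inj₁ tt) → ⊥-elim ∘ x∉root
      ; (inj₂ (inj₁ q)) → precedes q
      ; (inj₂ (inj₂ q)) occ₂ → ⊥-elim (d₁#d₂ (x∈₁ , proj₁ (occurrence⇒introduction d₂ u₂ x∉s₂ q occ₂))) }
  fromPremises (u₁ , u₂ , d₁#d₂) (inj₂ (inj₂ p)) occ =
    let x∈₂ , o , intro , precedes = occurrence⇒introduction d₂ u₂ x∉s₂ p occ in
    there (there (∈-++⁺ʳ (created d₁) x∈₂)) , inj₂ (inj₂ o) , intro , λ
      { (inj₁ tt) → ⊥-elim ∘ x∉root
      ; (inj₂ (inj₂ q)) → precedes q
      ; (inj₂ (inj₁ q)) occ₁ → ⊥-elim (d₁#d₂ (proj₁ (occurrence⇒introduction d₁ u₁ x∉s₁ q occ₁) , x∈₂)) }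

introduction⇒origin : ∀ {s} (d : Deriv s) {x o} → Introduces d x o → Origin (cons d) (⪯Π d) x o
introduction⇒origin d {o = o} (intro , precedes) =
  intro , (λ q intro′ → precedes q (relIntro⇒occurs d intro′)) ,
  λ { q (q⪯o , q≢o) occ → q≢o (⪯Π-antisym d q o q⪯o (precedes q occ)) }

wellFormed : ∀ {s} (d : Deriv s) → Unique (created d) → Ground s → IsWellFormed (cons d) (⪯Π d)
wellFormed {s} d u ground x (p , occ) =
  let _ , o , intro , precedes = occurrence⇒introduction d u (∉⇒Absent s (ground x)) p occ in
  o , introduction⇒origin d (intro , precedes) ,
  λ { o′ (intro′ , minimal′ , _) →
        ⪯Π-antisym d o′ o (minimal′ o intro) (precedes o′ (relIntro⇒occurs d intro′)) }

lemma7 : ∀ {s} (Π : Deriv s) → Unique (created Π) →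
           IsConstraintSystem (cons Π) (⪯Π Π) ×
           (Ground s → IsWellFormed (cons Π) (⪯Π Π))
lemma7 Π u = isConstraintSystem Π , wellFormed Π u
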